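{- Let $(\mathbf{C},\mathcal{M})$ satisfy the standing DPO assumptions of the context. Let $r=(O\xleftarrow{o}K\xrightarrow{i}I)$ and $r'=(O'\xleftarrow{o'}K'\xrightarrow{i'}I')$ be linear rules and $p^*:O\to O'$, $\bar p:K\to K'$, $p:I\to I'$ $\mathcal{M}$-morphisms such that $o'\bar p=p^*o$ and $i'\bar p=p\,i$ and both squares are pushouts. Let $\mathsf{c}_O$ be a condition over $O$. Then for all objects $X$ and all DPO-admissible matches $n\in M_{r'}(X)$, $$n\models\mathsf{Shift}(p,\mathsf{Trans}(r,\mathsf{c}_O))\iff n\models\mathsf{Trans}(r',\mathsf{Shift}(p^*,\mathsf{c}_O)),$$ i.e. $\mathsf{Shift}(p,\mathsf{Trans}(r,\mathsf{c}_O))\,\dot{\equiv}\,\mathsf{Trans}(r',\mathsf{Shift}(p^*,\mathsf{c}_O))$.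
   Context: Standing DPO assumptions: $(\mathbf{C},\mathcal{M})$ is $\mathcal{M}$-adhesive with $\mathcal{M}$ a class of monomorphisms (contains isos; closed under composition and decomposition; pushouts/pullbacks along $\mathcal{M}$-morphisms exist and $\mathcal{M}$ is stable under them; pushouts along $\mathcal{M}$-morphisms are $\mathcal{M}$-van Kampen squares); $\mathbf{C}$ has epi-$\mathcal{M}$-factorizations, is balanced, has a strict $\mathcal{M}$-initial object and $\mathcal{M}$-effective unions (if $\mathcal{M}$-morphisms $B\leftarrow A\to C$ have pushout $D$ and $\mathcal{M}$-morphisms $B\to E\leftarrow C$ form with them a pullback square, the induced $D\to E$ is in $\mathcal{M}$). Conditions over $P$: $\mathsf{true}$; $\exists(a,\mathsf{c}_Q)$ ($a:P\to Q$ in $\mathcal{M}$); $\neg$; $\bigwedge$; $\mathsf{false}=\neg\mathsf{true}$, $\bigvee=\neg\bigwedge\neg$. An $\mathcal{M}$-morphism $p$ satisfies $\exists(a,\mathsf{c}_Q)$ iff $p=q a$ for an $\mathcal{M}$-morphism $q\models\mathsf{c}_Q$. $\mathsf{Shift}(p,\cdot)$, defined along $\mathcal{M}$-morphisms $p:P\to Q$: commutes with $\mathsf{true},\neg,\bigwedge$; $\mathsf{Shift}(p,\exists(a:P\to A,\mathsf{c}_A))=\bigvee_{(r,s)}\exists(r,\mathsf{Shift}(s,\mathsf{c}_A))$ over iso classes of pushouts $(r:Q\to E,s:A\to E)$ of spans $Q\xleftarrow{p''}X\xrightarrow{a''}A$ of $\mathcal{M}$-morphisms admitting an $\mathcal{M}$-morphism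 $x:P\to X$ with $p''x=p$, $a''x=a$. Linear rules are spans of $\mathcal{M}$-morphisms. $\mathsf{Trans}(r,\mathsf{c}_O)$ for $r=(O\xleftarrow{o}K\xrightarrow{i}I)$: commutes with $\mathsf{true},\neg,\bigwedge$; for $\exists(a:O\to O'',\mathsf{c}')$: if a pushout complement $K\to K''\xrightarrow{o''}O''$ of $K\xrightarrow{o}O\xrightarrow{a}O''$ exists, with $I\xrightarrow{a^*}I''\xleftarrow{i''}K''$ the pushout of $I\xleftarrow{i}K\to K''$ and $r''=(O''\xleftarrow{o''}K''\xrightarrow{i''}I'')$, it is $\exists(a^*,\mathsf{Trans}(r'',\mathsf{c}'))$; otherwise $\mathsf{false}$. $M_{r'}(X)$: $\mathcal{M}$-morphisms $n:I'\to X$ such that $K'\xrightarrow{i'}I'\xrightarrow{n}X$ has a pushout complement. -}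

module Defs where

open import Level using (Level; _⊔_) renaming (suc to lsuc)
open import Data.Product using (Σ; _×_; _,_; proj₁; proj₂)
open import Data.Unit.Polymorphic using (⊤)
open import Relation.Nullary using (¬_)
open import Relation.Binary using (IsEquivalence)

record Category (o h e : Level) : Set (lsuc (o ⊔ h ⊔ e)) where
  infixr 9 _∘_
  infix 4 _≈_
  infix 4 _⇒_
  field
    Obj : Set o
    _⇒_ : Obj → Obj → Set h
    _≈_ : ∀ {A B} → A ⇒ B → A ⇒ B → Set e
    id : ∀ {A} → A ⇒ A
    _∘_ : ∀ {A B C} → B ⇒ C → A ⇒ B → A ⇒ C
    ≈-equiv : ∀ {A B} → IsEquivalence (_≈_ {A} {B})
    ∘-resp-≈ : ∀ {A B C} {f f′ : B ⇒ C} {g g′ : A ⇒ B} →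
               f ≈ f′ → g ≈ g′ → f ∘ g ≈ f′ ∘ g′
    assoc : ∀ {A B C D} {f : A ⇒ B} {g : B ⇒ C} {k : C ⇒ D} →
            (k ∘ g) ∘ f ≈ k ∘ (g ∘ f)
    identityˡ : ∀ {A B} {f : A ⇒ B} → id ∘ f ≈ f
    identityʳ : ∀ {A B} {f : A ⇒ B} → f ∘ id ≈ f

module CatDefs {o h e : Level} (𝒞 : Category o h e) where
  open Category 𝒞

  ≈-sym : ∀ {A B} {f g : A ⇒ B} → f ≈ g → g ≈ f
  ≈-sym = IsEquivalence.sym ≈-equiv

  Mono : ∀ {A B} → A ⇒ B → Set (o ⊔ h ⊔ e)
  Mono {A} f = ∀ {X} (g k : X ⇒ A) → f ∘ g ≈ f ∘ k → g ≈ k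

  Epi : ∀ {A B} → A ⇒ B → Set (o ⊔ h ⊔ e)
  Epi {B = B} f = ∀ {X} (g k : B ⇒ X) → g ∘ f ≈ k ∘ f → g ≈ k

  Iso : ∀ {A B} → A ⇒ B → Set (h ⊔ e)
  Iso {A} {B} f = Σ (B ⇒ A) λ g → (g ∘ f ≈ id) × (f ∘ g ≈ id)

  IsInitial : Obj → Set (o ⊔ h ⊔ e)
  IsInitial Z = ∀ A → Σ (Z ⇒ A) λ u → ∀ (v : Z ⇒ A) → v ≈ u

  record IsPushout {A B C D : Obj} (f : A ⇒ B) (g : A ⇒ C)
                   (i₁ : B ⇒ D) (i₂ : C ⇒ D) : Set (o ⊔ h ⊔ e) where
    field
      commute : i₁ ∘ f ≈ i₂ ∘ g
      universal : ∀ {E} (x : B ⇒ E) (y : C ⇒ E) → x ∘ f ≈ y ∘ g →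
                  Σ (D ⇒ E) λ u → (u ∘ i₁ ≈ x) × (u ∘ i₂ ≈ y)
      unique : ∀ {E} {u v : D ⇒ E} → u ∘ i₁ ≈ v ∘ i₁ → u ∘ i₂ ≈ v ∘ i₂ → u ≈ v

  record IsPullback {A B C P : Obj} (f : A ⇒ C) (g : B ⇒ C)
                    (p₁ : P ⇒ A) (p₂ : P ⇒ B) : Set (o ⊔ h ⊔ e) where
    field
      commute : f ∘ p₁ ≈ g ∘ p₂
      universal : ∀ {E} (x : E ⇒ A) (y : E ⇒ B) → f ∘ x ≈ g ∘ y →
                  Σ (E ⇒ P) λ u → (p₁ ∘ u ≈ x) × (p₂ ∘ u ≈ y)
      unique : ∀ {E} {u v : E ⇒ P} → p₁ ∘ u ≈ p₁ ∘ v → p₂ ∘ u ≈ p₂ ∘ v → u ≈ v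

  po-sym : ∀ {A B C D} {f : A ⇒ B} {g : A ⇒ C} {i₁ : B ⇒ D} {i₂ : C ⇒ D} →
           IsPushout f g i₁ i₂ → IsPushout g f i₂ i₁
  po-sym po = record
    { commute = ≈-sym (IsPushout.commute po)
    ; universal = λ x y eq →
        let (u , p , q) = IsPushout.universal po y x (≈-sym eq) in u , q , p
    ; unique = λ e₂ e₁ → IsPushout.unique po e₁ e₂
    }

record DPOSetting {o h e : Level} (𝒞 : Category o h e) (m : Level)
       : Set (lsuc (o ⊔ h ⊔ e ⊔ m)) where
  open Category 𝒞
  open CatDefs 𝒞
  field
    ℳ : ∀ {A B} → A ⇒ B → Set m
    ℳ-resp-≈ : ∀ {A B} {f g : A ⇒ B} → f ≈ g → ℳ f → ℳ g
    ℳ-mono : ∀ {A B} {f : A ⇒ B} → ℳ f → Mono f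
    ℳ-iso : ∀ {A B} {f : A ⇒ B} → Iso f → ℳ f
    ℳ-∘ : ∀ {A B C} {f : A ⇒ B} {g : B ⇒ C} → ℳ f → ℳ g → ℳ (g ∘ f)
    ℳ-decomp : ∀ {A B C} {f : A ⇒ B} {g : B ⇒ C} → ℳ (g ∘ f) → ℳ g → ℳ f
    pushout-along-ℳ : ∀ {A B C} (f : A ⇒ B) (g : A ⇒ C) → ℳ f →
      Σ Obj λ D → Σ (B ⇒ D) λ i₁ → Σ (C ⇒ D) λ i₂ → IsPushout f g i₁ i₂
    pushout-stable : ∀ {A B C D} {f : A ⇒ B} {g : A ⇒ C} {i₁ : B ⇒ D} {i₂ : C ⇒ D} →
      IsPushout f g i₁ i₂ → ℳ f → ℳ i₂
    pullback-along-ℳ : ∀ {A B C} (f : A ⇒ C) (g : B ⇒ C) → ℳ f →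
      Σ Obj λ P → Σ (P ⇒ A) λ p₁ → Σ (P ⇒ B) λ p₂ → IsPullback f g p₁ p₂
    pullback-stable : ∀ {A B C P} {f : A ⇒ C} {g : B ⇒ C} {p₁ : P ⇒ A} {p₂ : P ⇒ B} →
      IsPullback f g p₁ p₂ → ℳ f → ℳ p₂
    -- pushouts along ℳ-morphisms are ℳ-van Kampen squares:
    -- bottom face  A --f--> B, A --m--> C, B --n--> D, C --g--> D (pushout, f ∈ ℳ);
    -- top face     A′ --f′--> B′, ..., vertical a, b, c, d with b, c, d ∈ ℳ,
    -- all faces commute, back faces pullbacks  ⇒
    -- (top is pushout ⇔ both front faces are pullbacks).
    van-Kampen :
      ∀ {A B C D} {f : A ⇒ B} {mm : A ⇒ C} {n : B ⇒ D} {g : C ⇒ D} →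
      IsPushout f mm n g → ℳ f →
      ∀ {A′ B′ C′ D′} (f′ : A′ ⇒ B′) (m′ : A′ ⇒ C′) (n′ : B′ ⇒ D′) (g′ : C′ ⇒ D′)
        (a : A′ ⇒ A) (b : B′ ⇒ B) (c : C′ ⇒ C) (d : D′ ⇒ D) →
      ℳ b → ℳ c → ℳ d →
      n′ ∘ f′ ≈ g′ ∘ m′ →
      f ∘ a ≈ b ∘ f′ → mm ∘ a ≈ c ∘ m′ → n ∘ b ≈ d ∘ n′ → g ∘ c ≈ d ∘ g′ →
      IsPullback f b a f′ → IsPullback mm c a m′ →
      (IsPushout f′ m′ n′ g′ → IsPullback n d b n′ × IsPullback g d c g′) ×
      (IsPullback n d b n′ × IsPullback g d c g′ → IsPushout f′ m′ n′ g′)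
    epi-ℳ-factorization : ∀ {A B} (f : A ⇒ B) →
      Σ Obj λ Z → Σ (A ⇒ Z) λ ε → Σ (Z ⇒ B) λ μ → Epi ε × ℳ μ × (f ≈ μ ∘ ε)
    balanced : ∀ {A B} {f : A ⇒ B} → Mono f → Epi f → Iso f
    initial : Obj
    initial-isInitial : IsInitial initial
    initial-ℳ : ∀ {A} (u : initial ⇒ A) → ℳ u
    initial-strict : ∀ {A} (f : A ⇒ initial) → Iso f
    effective-unions :
      ∀ {A B C D E} {b : A ⇒ B} {c : A ⇒ C} {d₁ : B ⇒ D} {d₂ : C ⇒ D}
        {e₁ : B ⇒ E} {e₂ : C ⇒ E} →
      ℳ b → ℳ c → IsPushout b c d₁ d₂ →
      ℳ e₁ → ℳ e₂ → IsPullback e₁ e₂ b c →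
      ∀ (u : D ⇒ E) → u ∘ d₁ ≈ e₁ → u ∘ d₂ ≈ e₂ → ℳ u

module Conditions {o h e m : Level} (𝒞 : Category o h e) (𝒟 : DPOSetting 𝒞 m) where
  open Category 𝒞
  open CatDefs 𝒞
  open DPOSetting 𝒟

  ι : Level
  ι = o ⊔ h ⊔ e ⊔ m

  data Cond : Obj → Set (lsuc ι) where
    true : ∀ {P} → Cond P
    ∃c : ∀ {P Q} (a : P ⇒ Q) → ℳ a → Cond Q → Cond P
    ¬c : ∀ {P} → Cond P → Cond P
    ⋀ : ∀ {P} (J : Set ι) → (J → Cond P) → Cond P

  false : ∀ {P} → Cond P
  false = ¬c true

  ⋁ : ∀ {P} (J : Set ι) → (J → Cond P) → Cond P
  ⋁ J cs = ¬c (⋀ J (λ j → ¬c (cs j)))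

  infix 4 _⊨_
  _⊨_ : ∀ {P X} → P ⇒ X → Cond P → Set ι
  p ⊨ true = ⊤
  _⊨_ {X = X} p (∃c {Q = Q} a _ c) = Σ (Q ⇒ X) λ q → ℳ q × (p ≈ q ∘ a) × (q ⊨ c)
  p ⊨ ¬c c = ¬ (p ⊨ c)
  p ⊨ ⋀ J cs = ∀ j → p ⊨ cs j

  -- Data indexing the disjunction in Shift(p, ∃(a, c_A)):
  -- a span Q ← X → A of ℳ-morphisms with x : P → X in ℳ, p''x = p, a''x = a,
  -- together with a pushout (r : Q → E, s : A → E) of it.
  record ShiftIdx {P Q A : Obj} (p : P ⇒ Q) (a : P ⇒ A) : Set ι where
    field
      X : Obj
      p″ : X ⇒ Q
      a″ : X ⇒ A
      p″-ℳ : ℳ p″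
      a″-ℳ : ℳ a″
      x : P ⇒ X
      x-ℳ : ℳ x
      p″x≈p : p″ ∘ x ≈ p
      a″x≈a : a″ ∘ x ≈ a
      E : Obj
      r : Q ⇒ E
      s : A ⇒ E
      po : IsPushout p″ a″ r s

  Shift : ∀ {P Q} (p : P ⇒ Q) → ℳ p → Cond P → Cond Q
  Shift p pℳ true = true
  Shift p pℳ (¬c c) = ¬c (Shift p pℳ c)
  Shift p pℳ (⋀ J cs) = ⋀ J (λ j → Shift p pℳ (cs j))
  Shift p pℳ (∃c a aℳ c) =
    ⋁ (ShiftIdx p a) λ j →
      ∃c (ShiftIdx.r j) (pushout-stable (po-sym (ShiftIdx.po j)) (ShiftIdx.a″-ℳ j))
         (Shift (ShiftIdx.s j) (pushout-stable (ShiftIdx.po j) (ShiftIdx.p″-ℳ j)) c)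

  -- Data indexing Trans(r, ∃(a, c')) for r = (O ← K → I):
  -- a pushout complement K → K'' → O'' of K → O → O'' and the pushout
  -- I → I'' ← K'' of I ← K → K''.
  record TransIdx {O K I O″ : Obj} (o : K ⇒ O) (i : K ⇒ I) (a : O ⇒ O″) : Set ι where
    field
      K″ : Obj
      k : K ⇒ K″
      o″ : K″ ⇒ O″
      pc : IsPushout o k a o″
      I″ : Obj
      a* : I ⇒ I″
      i″ : K″ ⇒ I″
      po : IsPushout i k a* i″

  Trans : ∀ {O K I} (o : K ⇒ O) (i : K ⇒ I) → ℳ o → ℳ i → Cond O → Cond I
  Trans o i oℳ iℳ true = true
  Trans o i oℳ iℳ (¬c c) = ¬c (Trans o i oℳ iℳ c)
  Trans o i oℳ iℳ (⋀ J cs) = ⋀ J (λ j → Trans o i oℳ iℳ (cs j))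
  Trans o i oℳ iℳ (∃c a aℳ c′) =
    ⋁ (TransIdx o i a) λ j →
      let open TransIdx j
          o″ℳ = pushout-stable pc oℳ
          i″ℳ = pushout-stable po iℳ
          kℳ = ℳ-decomp (ℳ-resp-≈ (IsPushout.commute pc) (ℳ-∘ oℳ aℳ)) o″ℳ
          a*ℳ = pushout-stable (po-sym po) kℳ
      in ∃c a* a*ℳ (Trans o″ i″ o″ℳ i″ℳ c′)

  Admissible : ∀ {K′ I′ X} (i′ : K′ ⇒ I′) (n : I′ ⇒ X) → Set ι
  Admissible {K′} {I′} {X} i′ n =
    ℳ n × Σ Obj λ Y → Σ (K′ ⇒ Y) λ k → Σ (Y ⇒ X) λ y → IsPushout i′ k n y

-- Both transformations are correct for the classical reading ⊨ᶜ of conditions (∃ up to double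
-- negation): n ⊨ Shift p c iff n ∘ p ⊨ᶜ c for ℳ-morphisms n, and n ⊨ Trans r c iff m ⊨ᶜ c
-- whenever n and m are the two matches of a double-pushout diagram along r, while on the outputs
-- of Shift and Trans the two readings agree. An admissible n spans such a diagram along r′, and
-- pasting the pushouts along p and p* onto it gives one along r with matches n ∘ p and m ∘ p*;
-- so both sides are equivalent to m ∘ p* ⊨ᶜ c_O. For Trans, a factorisation of one match through
-- a ∃ is carried to the other match by splitting its pushout square with a pullback (van Kampen)
-- and comparing the resulting pushout complement with the one chosen by Trans.
module Submission where

open import Defs
open import Level using (Level; _⊔_) renaming (suc to lsuc)
open import Data.Unit.Polymorphic using (⊤)
open import Function.Bundles using (_⇔_; mk⇔; Equivalence)
open import Data.Product using (Σ; _×_; _,_; proj₁; proj₂)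
open import Function.Construct.Identity using (⇔-id)
open import Function.Construct.Symmetry using (⇔-sym)
open import Function.Related.Propositional using (module EquationalReasoning)
open import Function.Related.TypeIsomorphisms using (¬-cong-⇔)
open import Relation.Nullary using (¬_)
open import Relation.Binary using (IsEquivalence; Setoid)
import Relation.Binary.Reasoning.Setoid as SetoidReasoning

Π-cong-⇔ : ∀ {a b c} {J : Set a} {A : J → Set b} {B : J → Set c} →
           (∀ j → A j ⇔ B j) → (∀ j → A j) ⇔ (∀ j → B j)
Π-cong-⇔ A⇔B = mk⇔ (λ f j → Equivalence.to (A⇔B j) (f j)) (λ f j → Equivalence.from (A⇔B j) (f j))

¬∀¬⇔¬¬ : ∀ {a b c} {J : Set a} {A : J → Set b} {W : Set c} →
         (∀ j → A j → W) → (W → Σ J A) → (¬ (∀ j → ¬ A j)) ⇔ (¬ ¬ W)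
¬∀¬⇔¬¬ A⇒W W⇒ΣA =
  mk⇔ (λ ¬∀¬A ¬W → ¬∀¬A (λ j a → ¬W (A⇒W j a)))
      (λ ¬¬W ∀¬A → ¬¬W (λ w → let (j , a) = W⇒ΣA w in ∀¬A j a))

module CategoryLemmas {ℓo ℓh ℓe : Level} (𝒞 : Category ℓo ℓh ℓe) where
  open Category 𝒞
  open CatDefs 𝒞

  hom-setoid : Obj → Obj → Setoid ℓh ℓe
  hom-setoid A B = record { Carrier = A ⇒ B ; _≈_ = _≈_ ; isEquivalence = ≈-equiv }

  module HomReasoning {A B : Obj} = SetoidReasoning (hom-setoid A B)
  open HomReasoning public

  ≈-refl : ∀ {A B} {f : A ⇒ B} → f ≈ f
  ≈-refl = IsEquivalence.refl ≈-equiv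

  ≈-trans : ∀ {A B} {f g k : A ⇒ B} → f ≈ g → g ≈ k → f ≈ k
  ≈-trans = IsEquivalence.trans ≈-equiv

  infixr 4 _⟩∘⟨_ refl⟩∘⟨_
  infix 5 _⟩∘⟨refl
  _⟩∘⟨_ : ∀ {A B C} {f f′ : B ⇒ C} {g g′ : A ⇒ B} → f ≈ f′ → g ≈ g′ → f ∘ g ≈ f′ ∘ g′
  _⟩∘⟨_ = ∘-resp-≈

  refl⟩∘⟨_ : ∀ {A B C} {f : B ⇒ C} {g g′ : A ⇒ B} → g ≈ g′ → f ∘ g ≈ f ∘ g′
  refl⟩∘⟨_ = ≈-refl ⟩∘⟨_

  _⟩∘⟨refl : ∀ {A B C} {f f′ : B ⇒ C} {g : A ⇒ B} → f ≈ f′ → f ∘ g ≈ f′ ∘ g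
  f≈f′ ⟩∘⟨refl = f≈f′ ⟩∘⟨ ≈-refl

  assoc˘ : ∀ {A B C D} {f : A ⇒ B} {g : B ⇒ C} {k : C ⇒ D} → k ∘ (g ∘ f) ≈ (k ∘ g) ∘ f
  assoc˘ = ≈-sym assoc

  id-comm : ∀ {A B} {f : A ⇒ B} → f ∘ id ≈ id ∘ f
  id-comm = ≈-trans identityʳ (≈-sym identityˡ)

  id-mono : ∀ {A} → Mono (id {A})
  id-mono g k id∘g≈id∘k = ≈-trans (≈-sym identityˡ) (≈-trans id∘g≈id∘k identityˡ)

  pb-sym : ∀ {A B C P} {f : A ⇒ C} {g : B ⇒ C} {p₁ : P ⇒ A} {p₂ : P ⇒ B} →
           IsPullback f g p₁ p₂ → IsPullback g f p₂ p₁
  pb-sym pb = record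
    { commute = ≈-sym (IsPullback.commute pb)
    ; universal = λ x y eq →
        let (u , p₁u≈y , p₂u≈x) = IsPullback.universal pb y x (≈-sym eq) in u , p₂u≈x , p₁u≈y
    ; unique = λ e₁ e₂ → IsPullback.unique pb e₂ e₁
    }

  mono-pullback : ∀ {A B C} {n : A ⇒ C} {q : B ⇒ C} {a : A ⇒ B} →
                  Mono q → n ≈ q ∘ a → IsPullback n q id a
  mono-pullback {n = n} {q} {a} q-mono n≈qa = record
    { commute = ≈-trans identityʳ n≈qa
    ; universal = λ x y nx≈qy → x , identityˡ , q-mono _ _ (begin
        q ∘ a ∘ x    ≈⟨ assoc˘ ⟩
        (q ∘ a) ∘ x  ≈⟨ ≈-sym n≈qa ⟩∘⟨refl ⟩
        n ∘ x        ≈⟨ nx≈qy ⟩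
        q ∘ _        ∎)
    ; unique = λ id∘u≈id∘v _ → id-mono _ _ id∘u≈id∘v
    }

  id-pushout : ∀ {A C} (g : A ⇒ C) → IsPushout id g g id
  id-pushout g = record
    { commute = id-comm
    ; universal = λ x y x∘id≈y∘g → y , ≈-trans (≈-sym x∘id≈y∘g) identityʳ , identityʳ
    ; unique = λ _ u≈v → ≈-trans (≈-sym identityʳ) (≈-trans u≈v identityʳ)
    }

  pushout-of-id-section : ∀ {A R K} {u : A ⇒ R} {k : A ⇒ K} {r : R ⇒ K} →
                          IsPushout id u k r → Σ (K ⇒ R) λ s → (s ∘ k ≈ u) × (r ∘ s ≈ id)
  pushout-of-id-section {u = u} {k} {r} po =
    let (s , s∘k≈u , s∘r≈id) = IsPushout.universal po u id id-comm
    in s , s∘k≈u , IsPushout.unique po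
      (begin (r ∘ s) ∘ k  ≈⟨ assoc ⟩ r ∘ s ∘ k  ≈⟨ refl⟩∘⟨ s∘k≈u ⟩ r ∘ u
                          ≈⟨ ≈-sym (IsPushout.commute po) ⟩ k ∘ id  ≈⟨ id-comm ⟩ id ∘ k ∎)
      (begin (r ∘ s) ∘ r  ≈⟨ assoc ⟩ r ∘ s ∘ r  ≈⟨ refl⟩∘⟨ s∘r≈id ⟩ r ∘ id  ≈⟨ id-comm ⟩ id ∘ r ∎)

  pushout-compose : ∀ {A B C D E F} {f : A ⇒ B} {g₁ : A ⇒ C} {i₁ : B ⇒ D} {j₁ : C ⇒ D}
                      {g₂ : C ⇒ E} {i₂ : D ⇒ F} {j₂ : E ⇒ F} →
                    IsPushout f g₁ i₁ j₁ → IsPushout j₁ g₂ i₂ j₂ →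
                    IsPushout f (g₂ ∘ g₁) (i₂ ∘ i₁) j₂
  pushout-compose {f = f} {g₁} {i₁} {j₁} {g₂} {i₂} {j₂} P₁ P₂ = record
    { commute = begin
        (i₂ ∘ i₁) ∘ f    ≈⟨ assoc ⟩
        i₂ ∘ i₁ ∘ f      ≈⟨ refl⟩∘⟨ IsPushout.commute P₁ ⟩
        i₂ ∘ j₁ ∘ g₁     ≈⟨ assoc˘ ⟩
        (i₂ ∘ j₁) ∘ g₁   ≈⟨ IsPushout.commute P₂ ⟩∘⟨refl ⟩
        (j₂ ∘ g₂) ∘ g₁   ≈⟨ assoc ⟩
        j₂ ∘ g₂ ∘ g₁     ∎
    ; universal = λ x y x∘f≈y∘g₂g₁ →
        let (u₁ , u₁i₁≈x , u₁j₁≈yg₂) = IsPushout.universal P₁ x (y ∘ g₂) (≈-trans x∘f≈y∘g₂g₁ assoc˘)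
            (u₂ , u₂i₂≈u₁ , u₂j₂≈y) = IsPushout.universal P₂ u₁ y u₁j₁≈yg₂
        in u₂ , ≈-trans assoc˘ (≈-trans (u₂i₂≈u₁ ⟩∘⟨refl) u₁i₁≈x) , u₂j₂≈y
    ; unique = λ {_} {u} {v} ui₂i₁≈vi₂i₁ uj₂≈vj₂ →
        IsPushout.unique P₂
          (IsPushout.unique P₁ (≈-trans assoc (≈-trans ui₂i₁≈vi₂i₁ assoc˘)) (begin
            (u ∘ i₂) ∘ j₁   ≈⟨ assoc ⟩
            u ∘ i₂ ∘ j₁     ≈⟨ refl⟩∘⟨ IsPushout.commute P₂ ⟩
            u ∘ j₂ ∘ g₂     ≈⟨ assoc˘ ⟩
            (u ∘ j₂) ∘ g₂   ≈⟨ uj₂≈vj₂ ⟩∘⟨refl ⟩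
            (v ∘ j₂) ∘ g₂   ≈⟨ assoc ⟩
            v ∘ j₂ ∘ g₂     ≈⟨ refl⟩∘⟨ IsPushout.commute P₂ ⟨
            v ∘ i₂ ∘ j₁     ≈⟨ assoc˘ ⟩
            (v ∘ i₂) ∘ j₁   ∎))
          uj₂≈vj₂
    }

  pushout-decompose : ∀ {A B C D E F} {f : A ⇒ B} {g₁ : A ⇒ C} {i₁ : B ⇒ D} {j₁ : C ⇒ D}
                        {g₂ : C ⇒ E} {i₂ : D ⇒ F} {j₂ : E ⇒ F} {g : A ⇒ E} {i : B ⇒ F} →
                      IsPushout f g₁ i₁ j₁ → IsPushout f g i j₂ →
                      g₂ ∘ g₁ ≈ g → i₂ ∘ i₁ ≈ i → i₂ ∘ j₁ ≈ j₂ ∘ g₂ →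
                      IsPushout j₁ g₂ i₂ j₂
  pushout-decompose {f = f} {g₁} {i₁} {j₁} {g₂} {i₂} {j₂} {g} {i} P₁ P g₂g₁≈g i₂i₁≈i square = record
    { commute = square
    ; universal = λ x y xj₁≈yg₂ →
        let (u , ui≈xi₁ , uj₂≈y) = IsPushout.universal P (x ∘ i₁) y (begin
              (x ∘ i₁) ∘ f    ≈⟨ assoc ⟩
              x ∘ i₁ ∘ f      ≈⟨ refl⟩∘⟨ IsPushout.commute P₁ ⟩
              x ∘ j₁ ∘ g₁     ≈⟨ assoc˘ ⟩
              (x ∘ j₁) ∘ g₁   ≈⟨ xj₁≈yg₂ ⟩∘⟨refl ⟩
              (y ∘ g₂) ∘ g₁   ≈⟨ assoc ⟩
              y ∘ g₂ ∘ g₁     ≈⟨ refl⟩∘⟨ g₂g₁≈g ⟩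
              y ∘ g           ∎)
        in u
         , IsPushout.unique P₁
             (begin (u ∘ i₂) ∘ i₁  ≈⟨ assoc ⟩ u ∘ i₂ ∘ i₁  ≈⟨ refl⟩∘⟨ i₂i₁≈i ⟩ u ∘ i  ≈⟨ ui≈xi₁ ⟩ x ∘ i₁ ∎)
             (begin
               (u ∘ i₂) ∘ j₁   ≈⟨ assoc ⟩
               u ∘ i₂ ∘ j₁     ≈⟨ refl⟩∘⟨ square ⟩
               u ∘ j₂ ∘ g₂     ≈⟨ assoc˘ ⟩
               (u ∘ j₂) ∘ g₂   ≈⟨ uj₂≈y ⟩∘⟨refl ⟩
               y ∘ g₂          ≈⟨ xj₁≈yg₂ ⟨
               x ∘ j₁          ∎)
         , uj₂≈y
    ; unique = λ {_} {u} {v} ui₂≈vi₂ uj₂≈vj₂ →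
        IsPushout.unique P
          (begin
            u ∘ i           ≈⟨ refl⟩∘⟨ i₂i₁≈i ⟨
            u ∘ i₂ ∘ i₁     ≈⟨ assoc˘ ⟩
            (u ∘ i₂) ∘ i₁   ≈⟨ ui₂≈vi₂ ⟩∘⟨refl ⟩
            (v ∘ i₂) ∘ i₁   ≈⟨ assoc ⟩
            v ∘ i₂ ∘ i₁     ≈⟨ refl⟩∘⟨ i₂i₁≈i ⟩
            v ∘ i           ∎)
          uj₂≈vj₂
    }

  pushout-cancel : ∀ {A B C D E F} {f : A ⇒ B} {g₁ : A ⇒ C} {i₁ : B ⇒ D} {j₁ : C ⇒ D}
                     {g₂ : C ⇒ E} {j₂ : E ⇒ F} {g : A ⇒ E} {i : B ⇒ F} →
                   IsPushout f g₁ i₁ j₁ → IsPushout f g i j₂ → g₂ ∘ g₁ ≈ g →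
                   Σ (D ⇒ F) λ i₂ → (i₂ ∘ i₁ ≈ i) × IsPushout j₁ g₂ i₂ j₂
  pushout-cancel {f = f} {g₁} {g₂ = g₂} {j₂} {g} {i} P₁ P g₂g₁≈g =
    let (i₂ , i₂i₁≈i , i₂j₁≈j₂g₂) = IsPushout.universal P₁ i (j₂ ∘ g₂) (begin
          i ∘ f           ≈⟨ IsPushout.commute P ⟩
          j₂ ∘ g          ≈⟨ refl⟩∘⟨ g₂g₁≈g ⟨
          j₂ ∘ g₂ ∘ g₁    ≈⟨ assoc˘ ⟩
          (j₂ ∘ g₂) ∘ g₁  ∎)
    in i₂ , i₂i₁≈i , pushout-decompose P₁ P g₂g₁≈g i₂i₁≈i i₂j₁≈j₂g₂

module AdhesiveLemmas {ℓo ℓh ℓe ℓm : Level} (𝒞 : Category ℓo ℓh ℓe) (𝒟 : DPOSetting 𝒞 ℓm) where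
  open Category 𝒞
  open CatDefs 𝒞
  open DPOSetting 𝒟
  open CategoryLemmas 𝒞

  ℳ-id : ∀ {A} → ℳ (id {A})
  ℳ-id = ℳ-iso (id , identityˡ , identityˡ)

  pushout⇒pullback : ∀ {A B C D} {f : A ⇒ B} {g : A ⇒ C} {n : B ⇒ D} {n′ : C ⇒ D} →
                     IsPushout f g n n′ → ℳ f → IsPullback n n′ f g
  pushout⇒pullback {f = f} {g} {n′ = n′} po fℳ =
    proj₁ (proj₁ (van-Kampen po fℳ id g g id id f id n′ fℳ ℳ-id (pushout-stable po fℳ)
      id-comm ≈-refl id-comm (IsPushout.commute po) ≈-refl
      (mono-pullback (ℳ-mono fℳ) (≈-sym identityʳ)) (mono-pullback id-mono (≈-sym identityˡ)))
      (id-pushout g))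

  -- By van Kampen, the pullback R of j₁ and j₂ gives a pushout of id along K → R, so its leg
  -- R → K₂ has a section s, and ψ is the other leg composed with s.
  pushout-complement-unique :
    ∀ {K I J K₁ K₂} {i : K ⇒ I} {k₁ : K ⇒ K₁} {a : I ⇒ J} {j₁ : K₁ ⇒ J}
      {k₂ : K ⇒ K₂} {j₂ : K₂ ⇒ J} →
    IsPushout i k₁ a j₁ → IsPushout i k₂ a j₂ → ℳ i → ℳ j₁ → ℳ j₂ →
    Σ (K₂ ⇒ K₁) λ ψ → (ψ ∘ k₂ ≈ k₁) × (j₁ ∘ ψ ≈ j₂)
  pushout-complement-unique {i = i} {k₁} {j₁ = j₁} {k₂} {j₂} P₁ P₂ iℳ j₁ℳ j₂ℳ =
    let (R , r₁ , r₂ , pb) = pullback-along-ℳ j₁ j₂ j₁ℳ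
        r₁ℳ = pullback-stable (pb-sym pb) j₂ℳ
        (u , r₁u≈k₁ , r₂u≈k₂) = IsPullback.universal pb k₁ k₂
                                   (≈-trans (≈-sym (IsPushout.commute P₁)) (IsPushout.commute P₂))
        top = proj₂ (van-Kampen P₁ iℳ id u k₂ r₂ id i r₁ j₂ iℳ r₁ℳ j₂ℳ
                (≈-trans identityʳ (≈-sym r₂u≈k₂)) ≈-refl (≈-trans identityʳ (≈-sym r₁u≈k₁))
                (IsPushout.commute P₂) (IsPullback.commute pb)
                (mono-pullback (ℳ-mono iℳ) (≈-sym identityʳ)) (mono-pullback (ℳ-mono r₁ℳ) (≈-sym r₁u≈k₁)))
                (pushout⇒pullback P₂ iℳ , pb)
        (s , s∘k₂≈u , r₂∘s≈id) = pushout-of-id-section top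
    in r₁ ∘ s
     , (begin (r₁ ∘ s) ∘ k₂  ≈⟨ assoc ⟩ r₁ ∘ s ∘ k₂  ≈⟨ refl⟩∘⟨ s∘k₂≈u ⟩ r₁ ∘ u  ≈⟨ r₁u≈k₁ ⟩ k₁ ∎)
     , (begin
         j₁ ∘ r₁ ∘ s    ≈⟨ assoc˘ ⟩
         (j₁ ∘ r₁) ∘ s  ≈⟨ IsPullback.commute pb ⟩∘⟨refl ⟩
         (j₂ ∘ r₂) ∘ s  ≈⟨ assoc ⟩
         j₂ ∘ r₂ ∘ s    ≈⟨ refl⟩∘⟨ r₂∘s≈id ⟩
         j₂ ∘ id        ≈⟨ identityʳ ⟩
         j₂             ∎)

  record PushoutSplit {K O Y Z O₂} (o : K ⇒ O) (k : K ⇒ Y) (a : O ⇒ O₂) (q : O₂ ⇒ Z) (z : Y ⇒ Z)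
                      : Set (ℓo ⊔ ℓh ⊔ ℓe ⊔ ℓm) where
    field
      K₂ : Obj
      k₁ : K ⇒ K₂
      o₂ : K₂ ⇒ O₂
      k₂ : K₂ ⇒ Y
      k₂-ℳ : ℳ k₂
      k₂∘k₁≈k : k₂ ∘ k₁ ≈ k
      left : IsPushout o k₁ a o₂
      right : IsPushout o₂ k₂ q z

  -- K₂ is the pullback of q and z; van Kampen makes the left square a pushout.
  pushout-split : ∀ {K O Y Z O₂} {o : K ⇒ O} {k : K ⇒ Y} {m : O ⇒ Z} {z : Y ⇒ Z} →
                  IsPushout o k m z → ℳ o →
                  (a : O ⇒ O₂) {q : O₂ ⇒ Z} → ℳ q → m ≈ q ∘ a → PushoutSplit o k a q z
  pushout-split {o = o} {k} {m} {z} po oℳ a {q} qℳ m≈qa =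
    let (K₂ , o₂ , k₂ , pb) = pullback-along-ℳ q z qℳ
        k₂ℳ = pullback-stable pb qℳ
        (k₁ , o₂k₁≈ao , k₂k₁≈k) = IsPullback.universal pb (a ∘ o) k (begin
          q ∘ a ∘ o    ≈⟨ assoc˘ ⟩
          (q ∘ a) ∘ o  ≈⟨ ≈-sym m≈qa ⟩∘⟨refl ⟩
          m ∘ o        ≈⟨ IsPushout.commute po ⟩
          z ∘ k        ∎)
        left = proj₂ (van-Kampen po oℳ o k₁ a o₂ id id k₂ q ℳ-id k₂ℳ qℳ
                 (≈-sym o₂k₁≈ao) id-comm (≈-trans identityʳ (≈-sym k₂k₁≈k))
                 (≈-trans identityʳ m≈qa) (≈-sym (IsPullback.commute pb))
                 (mono-pullback id-mono (≈-sym identityˡ)) (mono-pullback (ℳ-mono k₂ℳ) (≈-sym k₂k₁≈k)))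
                 (mono-pullback (ℳ-mono qℳ) m≈qa , pb-sym pb)
    in record
      { K₂ = K₂ ; k₁ = k₁ ; o₂ = o₂ ; k₂ = k₂ ; k₂-ℳ = k₂ℳ ; k₂∘k₁≈k = k₂k₁≈k
      ; left = left
      ; right = pushout-decompose left po k₂k₁≈k (≈-sym m≈qa) (IsPullback.commute pb)
      }

module Satisfaction {ℓo ℓh ℓe ℓm : Level} (𝒞 : Category ℓo ℓh ℓe) (𝒟 : DPOSetting 𝒞 ℓm) where
  open Category 𝒞
  open CatDefs 𝒞
  open DPOSetting 𝒟
  open Conditions 𝒞 𝒟
  open CategoryLemmas 𝒞
  open AdhesiveLemmas 𝒞 𝒟

  -- Shift and Trans produce ⋁ = ¬⋀¬, whose satisfaction only yields the double negation of a
  -- witness; they are therefore correct for the reading of ∃ up to double negation.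
  infix 4 _⊨ᶜ_
  _⊨ᶜ_ : ∀ {P X} → P ⇒ X → Cond P → Set ι
  p ⊨ᶜ true = ⊤
  _⊨ᶜ_ {X = X} p (∃c {Q = Q} a _ c) = ¬ ¬ Σ (Q ⇒ X) λ q → ℳ q × (p ≈ q ∘ a) × (q ⊨ᶜ c)
  p ⊨ᶜ ¬c c = ¬ (p ⊨ᶜ c)
  p ⊨ᶜ ⋀ J cs = ∀ j → p ⊨ᶜ cs j

  ⊨ᶜ-resp-≈ : ∀ {P X} (c : Cond P) {p p′ : P ⇒ X} → p ≈ p′ → p ⊨ᶜ c → p′ ⊨ᶜ c
  ⊨ᶜ-resp-≈ true p≈p′ sat = sat
  ⊨ᶜ-resp-≈ (∃c a _ c) p≈p′ sat =
    λ ¬σ → sat (λ (q , qℳ , p≈qa , q⊨c) → ¬σ (q , qℳ , ≈-trans (≈-sym p≈p′) p≈qa , q⊨c))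
  ⊨ᶜ-resp-≈ (¬c c) p≈p′ sat = λ p′⊨c → sat (⊨ᶜ-resp-≈ c (≈-sym p≈p′) p′⊨c)
  ⊨ᶜ-resp-≈ (⋀ J cs) p≈p′ sat = λ j → ⊨ᶜ-resp-≈ (cs j) p≈p′ (sat j)

  -- Conditions in which every ∃ occurs as a disjunct of a ⋁; on them ⊨ and ⊨ᶜ agree.
  data Stable : {P : Obj} → Cond P → Set (lsuc ι) where
    true : ∀ {P} → Stable (true {P})
    ¬c : ∀ {P} {c : Cond P} → Stable c → Stable (¬c c)
    ⋀ : ∀ {P} (J : Set ι) {cs : J → Cond P} → (∀ j → Stable (cs j)) → Stable (⋀ J cs)
    ⋁∃ : ∀ {P} (J : Set ι) {Q : J → Obj} {a : ∀ j → P ⇒ Q j} {aℳ : ∀ j → ℳ (a j)}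
           {d : ∀ j → Cond (Q j)} → (∀ j → Stable (d j)) →
         Stable (⋁ J (λ j → ∃c (a j) (aℳ j) (d j)))

  ⊨⇔⊨ᶜ : ∀ {P} {c : Cond P} → Stable c → ∀ {X} (p : P ⇒ X) → (p ⊨ c) ⇔ (p ⊨ᶜ c)
  ⊨⇔⊨ᶜ true p = ⇔-id _
  ⊨⇔⊨ᶜ (¬c s) p = ¬-cong-⇔ (⊨⇔⊨ᶜ s p)
  ⊨⇔⊨ᶜ (⋀ J ss) p = Π-cong-⇔ λ j → ⊨⇔⊨ᶜ (ss j) p
  ⊨⇔⊨ᶜ (⋁∃ J ss) p = mk⇔
    (λ ¬∀¬ ∀¬ᶜ → ¬∀¬ (λ j (q , qℳ , p≈qa , sat) →
       ∀¬ᶜ j (λ ¬σᶜ → ¬σᶜ (q , qℳ , p≈qa , Equivalence.to (⊨⇔⊨ᶜ (ss j) q) sat))))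
    (λ ¬∀¬ᶜ ∀¬ → ¬∀¬ᶜ (λ j ¬¬σᶜ → ¬¬σᶜ (λ (q , qℳ , p≈qa , sat) →
       ∀¬ j (q , qℳ , p≈qa , Equivalence.from (⊨⇔⊨ᶜ (ss j) q) sat))))

  Shift-stable : ∀ {P Q} (p : P ⇒ Q) (pℳ : ℳ p) (c : Cond P) → Stable (Shift p pℳ c)
  Shift-stable p pℳ true = true
  Shift-stable p pℳ (¬c c) = ¬c (Shift-stable p pℳ c)
  Shift-stable p pℳ (⋀ J cs) = ⋀ J (λ j → Shift-stable p pℳ (cs j))
  Shift-stable p pℳ (∃c a _ c) = ⋁∃ (ShiftIdx p a) λ j →
    Shift-stable (ShiftIdx.s j) (pushout-stable (ShiftIdx.po j) (ShiftIdx.p″-ℳ j)) c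

  Trans-stable : ∀ {O K I} (o : K ⇒ O) (i : K ⇒ I) (oℳ : ℳ o) (iℳ : ℳ i) (c : Cond O) →
                 Stable (Trans o i oℳ iℳ c)
  Trans-stable o i oℳ iℳ true = true
  Trans-stable o i oℳ iℳ (¬c c) = ¬c (Trans-stable o i oℳ iℳ c)
  Trans-stable o i oℳ iℳ (⋀ J cs) = ⋀ J (λ j → Trans-stable o i oℳ iℳ (cs j))
  Trans-stable o i oℳ iℳ (∃c a _ c) = ⋁∃ (TransIdx o i a) λ t →
    Trans-stable (TransIdx.o″ t) (TransIdx.i″ t)
                 (pushout-stable (TransIdx.pc t) oℳ) (pushout-stable (TransIdx.po t) iℳ) c

  ShiftIdx-of : ∀ {P Q A X} {p : P ⇒ Q} {a : P ⇒ A} {n : Q ⇒ X} {q : A ⇒ X} →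
                ℳ p → ℳ n → ℳ q → n ∘ p ≈ q ∘ a →
                Σ (ShiftIdx p a) λ j → Σ (ShiftIdx.E j ⇒ X) λ u →
                  ℳ u × (u ∘ ShiftIdx.r j ≈ n) × (u ∘ ShiftIdx.s j ≈ q)
  ShiftIdx-of {p = p} {a} {n} {q} pℳ nℳ qℳ np≈qa =
    let (X₀ , n″ , q″ , pb) = pullback-along-ℳ n q nℳ
        n″ℳ = pullback-stable (pb-sym pb) qℳ
        q″ℳ = pullback-stable pb nℳ
        (x , n″x≈p , q″x≈a) = IsPullback.universal pb p a np≈qa
        (E , r , s , po) = pushout-along-ℳ n″ q″ n″ℳ
        (u , ur≈n , us≈q) = IsPushout.universal po n q (IsPullback.commute pb)
    in record
         { X = X₀ ; p″ = n″ ; a″ = q″ ; p″-ℳ = n″ℳ ; a″-ℳ = q″ℳ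
         ; x = x ; x-ℳ = ℳ-decomp (ℳ-resp-≈ (≈-sym n″x≈p) pℳ) n″ℳ
         ; p″x≈p = n″x≈p ; a″x≈a = q″x≈a ; E = E ; r = r ; s = s ; po = po }
     , u , effective-unions n″ℳ q″ℳ po nℳ qℳ pb u ur≈n us≈q , ur≈n , us≈q

  ⊨-Shift⇔ : ∀ {P Q} (p : P ⇒ Q) (pℳ : ℳ p) (c : Cond P) {X} {n : Q ⇒ X} → ℳ n →
             (n ⊨ Shift p pℳ c) ⇔ (n ∘ p ⊨ᶜ c)
  ⊨-Shift⇔ p pℳ true nℳ = ⇔-id _
  ⊨-Shift⇔ p pℳ (¬c c) nℳ = ¬-cong-⇔ (⊨-Shift⇔ p pℳ c nℳ)
  ⊨-Shift⇔ p pℳ (⋀ J cs) nℳ = Π-cong-⇔ λ j → ⊨-Shift⇔ p pℳ (cs j) nℳ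
  ⊨-Shift⇔ p pℳ (∃c a _ c) {n = n} nℳ = ¬∀¬⇔¬¬
    (λ j (q , qℳ , n≈qr , sat) →
      let open ShiftIdx j
      in q ∘ s , ℳ-∘ (pushout-stable po p″-ℳ) qℳ
       , (begin
           n ∘ p                ≈⟨ n≈qr ⟩∘⟨ ≈-sym p″x≈p ⟩
           (q ∘ r) ∘ p″ ∘ x     ≈⟨ assoc ⟩
           q ∘ r ∘ p″ ∘ x       ≈⟨ refl⟩∘⟨ assoc˘ ⟩
           q ∘ (r ∘ p″) ∘ x     ≈⟨ refl⟩∘⟨ IsPushout.commute po ⟩∘⟨refl ⟩
           q ∘ (s ∘ a″) ∘ x     ≈⟨ refl⟩∘⟨ assoc ⟩
           q ∘ s ∘ a″ ∘ x       ≈⟨ refl⟩∘⟨ refl⟩∘⟨ a″x≈a ⟩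
           q ∘ s ∘ a            ≈⟨ assoc˘ ⟩
           (q ∘ s) ∘ a          ∎)
       , Equivalence.to (⊨-Shift⇔ s (pushout-stable po p″-ℳ) c qℳ) sat)
    (λ (q , qℳ , np≈qa , sat) →
      let (j , u , uℳ , ur≈n , us≈q) = ShiftIdx-of pℳ nℳ qℳ np≈qa
          open ShiftIdx j
      in j , u , uℳ , ≈-sym ur≈n
       , Equivalence.from (⊨-Shift⇔ s (pushout-stable po p″-ℳ) c uℳ) (⊨ᶜ-resp-≈ c (≈-sym us≈q) sat))

  record DPO {K O I X Z} (o : K ⇒ O) (i : K ⇒ I) (n : I ⇒ X) (m : O ⇒ Z) : Set ι where
    field
      D : Obj
      k : K ⇒ D
      y : D ⇒ X
      z : D ⇒ Z
      I-pushout : IsPushout i k n y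
      O-pushout : IsPushout o k m z

  admissible⇒DPO : ∀ {K O I X} {o : K ⇒ O} {i : K ⇒ I} {n : I ⇒ X} → ℳ o → ℳ i →
                   Admissible i n → Σ Obj λ Z → Σ (O ⇒ Z) λ m → ℳ m × DPO o i n m
  admissible⇒DPO {o = o} oℳ iℳ (nℳ , D , k , y , I-pushout) =
    let kℳ = ℳ-decomp (ℳ-resp-≈ (IsPushout.commute I-pushout) (ℳ-∘ iℳ nℳ)) (pushout-stable I-pushout iℳ)
        (Z , m , z , O-pushout) = pushout-along-ℳ o k oℳ
    in Z , m , pushout-stable (po-sym O-pushout) kℳ
     , record { D = D ; k = k ; y = y ; z = z ; I-pushout = I-pushout ; O-pushout = O-pushout }

  DPO-paste : ∀ {K O I K′ O′ I′ X Z} {o : K ⇒ O} {i : K ⇒ I} {o′ : K′ ⇒ O′} {i′ : K′ ⇒ I′}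
                {p̄ : K ⇒ K′} {p* : O ⇒ O′} {p : I ⇒ I′} {n : I′ ⇒ X} {m : O′ ⇒ Z} →
              IsPushout o p̄ p* o′ → IsPushout i p̄ p i′ → DPO o′ i′ n m → DPO o i (n ∘ p) (m ∘ p*)
  DPO-paste {p̄ = p̄} O-square I-square d = record
    { D = D ; k = k ∘ p̄ ; y = y ; z = z
    ; I-pushout = pushout-compose I-square I-pushout
    ; O-pushout = pushout-compose O-square O-pushout
    }
    where open DPO d

  DPO-restrict : ∀ {K O I O₂ X Z} {o : K ⇒ O} {i : K ⇒ I} {a : O ⇒ O₂} {n : I ⇒ X} {m : O ⇒ Z} →
                 ℳ i → DPO o i n m → (t : TransIdx o i a) →
                 ∀ {q : TransIdx.I″ t ⇒ X} → ℳ q → n ≈ q ∘ TransIdx.a* t →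
                 Σ (O₂ ⇒ Z) λ w → ℳ w × (m ≈ w ∘ a) × DPO (TransIdx.o″ t) (TransIdx.i″ t) q w
  DPO-restrict iℳ d t {q} qℳ n≈qa* =
    let open DPO d
        open TransIdx t using (o″; i″; a*; pc; po) renaming (k to k″)
        split = pushout-split I-pushout iℳ a* qℳ n≈qa*
        open PushoutSplit split using (k₁; o₂; k₂; k₂∘k₁≈k; left; right)
        i″ℳ = pushout-stable po iℳ
        (ψ , ψk″≈k₁ , o₂ψ≈i″) = pushout-complement-unique left po iℳ (pushout-stable left iℳ) i″ℳ
        k₂ψk″≈k = begin
          (k₂ ∘ ψ) ∘ k″  ≈⟨ assoc ⟩
          k₂ ∘ ψ ∘ k″    ≈⟨ refl⟩∘⟨ ψk″≈k₁ ⟩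
          k₂ ∘ k₁        ≈⟨ k₂∘k₁≈k ⟩
          k              ∎
        qi″≈yk₂ψ = begin
          q ∘ i″          ≈⟨ refl⟩∘⟨ o₂ψ≈i″ ⟨
          q ∘ o₂ ∘ ψ      ≈⟨ assoc˘ ⟩
          (q ∘ o₂) ∘ ψ    ≈⟨ IsPushout.commute right ⟩∘⟨refl ⟩
          (y ∘ k₂) ∘ ψ    ≈⟨ assoc ⟩
          y ∘ k₂ ∘ ψ      ∎
        (w , wa≈m , O-pushout′) = pushout-cancel pc O-pushout k₂ψk″≈k
        k₂ψℳ = ℳ-decomp (ℳ-resp-≈ qi″≈yk₂ψ (ℳ-∘ i″ℳ qℳ)) (pushout-stable I-pushout iℳ)
    in w , pushout-stable (po-sym O-pushout′) k₂ψℳ , ≈-sym wa≈m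
     , record { D = D ; k = k₂ ∘ ψ ; y = y ; z = z ; O-pushout = O-pushout′
              ; I-pushout = pushout-decompose po I-pushout k₂ψk″≈k (≈-sym n≈qa*) qi″≈yk₂ψ }

  DPO-extend : ∀ {K O I O₂ X Z} {o : K ⇒ O} {i : K ⇒ I} {a : O ⇒ O₂} {n : I ⇒ X} {m : O ⇒ Z} →
               ℳ o → ℳ i → DPO o i n m → ∀ {q : O₂ ⇒ Z} → ℳ q → m ≈ q ∘ a →
               Σ (TransIdx o i a) λ t → Σ (TransIdx.I″ t ⇒ X) λ q′ →
                 ℳ q′ × (n ≈ q′ ∘ TransIdx.a* t) × DPO (TransIdx.o″ t) (TransIdx.i″ t) q′ q
  DPO-extend {i = i} {a} oℳ iℳ d qℳ m≈qa =
    let open DPO d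
        split = pushout-split O-pushout oℳ a qℳ m≈qa
        open PushoutSplit split using (K₂; k₁; o₂; k₂; k₂-ℳ; k₂∘k₁≈k; left; right)
        (I₂ , a* , i₂ , po) = pushout-along-ℳ i k₁ iℳ
        (q′ , q′a*≈n , I-pushout′) = pushout-cancel po I-pushout k₂∘k₁≈k
    in record { K″ = K₂ ; k = k₁ ; o″ = o₂ ; pc = left ; I″ = I₂ ; a* = a* ; i″ = i₂ ; po = po }
     , q′ , pushout-stable (po-sym I-pushout′) k₂-ℳ , ≈-sym q′a*≈n
     , record { D = D ; k = k₂ ; y = y ; z = z ; I-pushout = I-pushout′ ; O-pushout = right }

  ⊨-Trans⇔ : ∀ {K O I} {o : K ⇒ O} {i : K ⇒ I} (oℳ : ℳ o) (iℳ : ℳ i) (c : Cond O) →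
             ∀ {X Z} {n : I ⇒ X} {m : O ⇒ Z} → DPO o i n m → (n ⊨ Trans o i oℳ iℳ c) ⇔ (m ⊨ᶜ c)
  ⊨-Trans⇔ oℳ iℳ true d = ⇔-id _
  ⊨-Trans⇔ oℳ iℳ (¬c c) d = ¬-cong-⇔ (⊨-Trans⇔ oℳ iℳ c d)
  ⊨-Trans⇔ oℳ iℳ (⋀ J cs) d = Π-cong-⇔ λ j → ⊨-Trans⇔ oℳ iℳ (cs j) d
  ⊨-Trans⇔ oℳ iℳ (∃c _ _ c) d = ¬∀¬⇔¬¬
    (λ t (q , qℳ , n≈qa* , sat) →
      let (w , wℳ , m≈wa , d′) = DPO-restrict iℳ d t qℳ n≈qa*
          open TransIdx t
      in w , wℳ , m≈wa
       , Equivalence.to (⊨-Trans⇔ (pushout-stable pc oℳ) (pushout-stable po iℳ) c d′) sat)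
    (λ (q , qℳ , m≈qa , sat) →
      let (t , q′ , q′ℳ , n≈q′a* , d′) = DPO-extend oℳ iℳ d qℳ m≈qa
          open TransIdx t
      in t , q′ , q′ℳ , n≈q′a*
       , Equivalence.from (⊨-Trans⇔ (pushout-stable pc oℳ) (pushout-stable po iℳ) c d′) sat)

lemma4p11 :
  ∀ {o h e m : Level} (𝒞 : Category o h e) (𝒟 : DPOSetting 𝒞 m) →
  let open Category 𝒞
      open CatDefs 𝒞
      open DPOSetting 𝒟
      open Conditions 𝒞 𝒟
  in
  ∀ {O K I O′ K′ I′ : Obj}
    (o : K ⇒ O) (i : K ⇒ I) (oℳ : ℳ o) (iℳ : ℳ i)
    (o′ : K′ ⇒ O′) (i′ : K′ ⇒ I′) (o′ℳ : ℳ o′) (i′ℳ : ℳ i′)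
    (p* : O ⇒ O′) (p̄ : K ⇒ K′) (p : I ⇒ I′)
    (p*ℳ : ℳ p*) (p̄ℳ : ℳ p̄) (pℳ : ℳ p) →
    o′ ∘ p̄ ≈ p* ∘ o → i′ ∘ p̄ ≈ p ∘ i →
    IsPushout o p̄ p* o′ → IsPushout i p̄ p i′ →
    (cO : Cond O) →
    ∀ {X : Obj} (n : I′ ⇒ X) → Admissible i′ n →
    (n ⊨ Shift p pℳ (Trans o i oℳ iℳ cO))
      ⇔ (n ⊨ Trans o′ i′ o′ℳ i′ℳ (Shift p* p*ℳ cO))
-- The commutation hypotheses and ℳ p̄ are already contained in the two pushout squares.
lemma4p11 𝒞 𝒟 o i oℳ iℳ o′ i′ o′ℳ i′ℳ p* p̄ p p*ℳ _ pℳ _ _ O-square I-square cO n admissible =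
  let (_ , m , mℳ , d) = admissible⇒DPO o′ℳ i′ℳ admissible
  in begin
    n ⊨ Shift p pℳ (Trans o i oℳ iℳ cO)          ∼⟨ ⊨-Shift⇔ p pℳ (Trans o i oℳ iℳ cO) (proj₁ admissible) ⟩
    n ∘ p ⊨ᶜ Trans o i oℳ iℳ cO                  ∼⟨ ⇔-sym (⊨⇔⊨ᶜ (Trans-stable o i oℳ iℳ cO) (n ∘ p)) ⟩
    n ∘ p ⊨ Trans o i oℳ iℳ cO                   ∼⟨ ⊨-Trans⇔ oℳ iℳ cO (DPO-paste O-square I-square d) ⟩
    m ∘ p* ⊨ᶜ cO                                 ∼⟨ ⇔-sym (⊨-Shift⇔ p* p*ℳ cO mℳ) ⟩
    m ⊨ Shift p* p*ℳ cO                          ∼⟨ ⊨⇔⊨ᶜ (Shift-stable p* p*ℳ cO) m ⟩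
    m ⊨ᶜ Shift p* p*ℳ cO                         ∼⟨ ⇔-sym (⊨-Trans⇔ o′ℳ i′ℳ (Shift p* p*ℳ cO) d) ⟩
    n ⊨ Trans o′ i′ o′ℳ i′ℳ (Shift p* p*ℳ cO)    ∎
  where
  open Category 𝒞
  open Conditions 𝒞 𝒟
  open Satisfaction 𝒞 𝒟
  open EquationalReasoning
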